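{- Let $\alpha\in\mathcal{C}_n$ and $i\in[n-1]$, and suppose $\alpha$ is both $(i,z_1)$-removable and $(i,z_2)$-removable, where $z_1,z_2\in[\alpha_i]$. Then: (i) $z_1=z_2$ if and only if $\tilde J(i,z_1)=\tilde J(i,z_2)$; (ii) $z_1>z_2$ if and only if $\tilde J(i,z_1)<\tilde J(i,z_2)$.
   Context: $[n]=\{1,\dots,n\}$. A (weak) composition is a finite sequence of nonnegative integers $(\alpha_1,\dots,\alpha_m)$ with $\alpha_k=0$ for $k>m$; $|\alpha|=\sum\alpha_k$. $\mathcal{C}_n$ is the set of compositions $(\alpha_1,\dots,\alpha_{n-1})$ with $0\leqslant\alpha_i\leqslant n-i$. For a composition $\alpha$, a positive integer $i$ and $j\in\mathbb{N}$: $c_{i,j}(\alpha)=0$ if $j\leqslant i+1$; for $j>i+1$, $c_{i,j}(\alpha)=c_{i,j-1}(\alpha)+1$ if $\alpha_{j-1}<\alpha_i-c_{i,j-1}(\alpha)$ and $c_{i,j}(\alpha)=c_{i,j-1}(\alpha)$ otherwise. For compositions with $|\alpha|=|\alpha'|+1$, $\alpha$ covers $\alpha'$ if there are positive integers $i<j$ with: (a1) $\alpha'_i\leqslant\alpha_i-1$; (a2) $\alpha'_j=\alpha_j+\alpha_i-\alpha'_i-1$; (a3) $\alpha'_k=\alpha_k$ for $k\neq i,j$; (a4) $c_{i,j}(\alpha)=c_{i,j}(\alpha')=\alpha'_i-\alpha_j$. For $\alpha\in\mathcal{C}_n$, $i\in[n-1]$, $z\in[\alpha_i]$: $\alpha$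 is $(i,z)$-removable if there exists a composition $\alpha'$ with $\alpha$ covering $\alpha'$ and $\alpha'_i=\alpha_i-z$. With $\tilde\alpha$ defined by $\tilde\alpha_i=\alpha_i-z$, $\tilde\alpha_m=\alpha_m$ ($m\neq i$), set $\tilde J(i,z)=\max\{j>i:c_{i,j}(\alpha)=c_{i,j}(\tilde\alpha)\}$. -}

module Defs where

open import Data.Nat using (ℕ; zero; suc; _+_; _∸_; _≤_; _<_; _<?_; _≤?_; _≟_)
open import Data.List using (List; []; _∷_; length)
open import Data.Nat.ListAction using (sum)
open import Data.Product using (_×_; Σ; ∃; ∃-syntax; _,_)
open import Data.Bool using (if_then_else_)
open import Relation.Nullary using (does; ¬_)
open import Relation.Binary.PropositionalEquality using (_≡_)

-- A (weak) composition is a finite list of naturals; entries are indexed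
-- from 1 and are 0 beyond the length (and at index 0, which is unused).
Composition : Set
Composition = List ℕ

entry : Composition → ℕ → ℕ
entry []       _             = 0
entry (x ∷ xs) zero          = 0
entry (x ∷ xs) (suc zero)    = x
entry (x ∷ xs) (suc (suc k)) = entry xs (suc k)

size : Composition → ℕ
size = sum

InC : ℕ → Composition → Set
InC n α = length α ≡ n ∸ 1 × (∀ k → 1 ≤ k → k ≤ n ∸ 1 → entry α k ≤ n ∸ k)

-- c_{i,j}(α), with the composition given by its entry function k ↦ α_k.
-- (Truncated subtraction is harmless: the recursion keeps c ≤ α_i.)
c : ℕ → ℕ → (ℕ → ℕ) → ℕ
c i zero    a = 0
c i (suc j) a =
  if does (suc j ≤? suc i) then 0
  else (if does (a j <? (a i ∸ c i j a)) then suc (c i j a) else c i j a)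

Covers : Composition → Composition → Set
Covers α α' =
  size α ≡ size α' + 1 ×
  ∃[ i ] ∃[ j ] (1 ≤ i × i < j ×
    suc (entry α' i) ≤ entry α i ×
    entry α' j ≡ entry α j + (entry α i ∸ entry α' i ∸ 1) ×
    (∀ k → ¬ k ≡ i → ¬ k ≡ j → entry α' k ≡ entry α k) ×
    c i j (entry α) ≡ c i j (entry α') ×
    c i j (entry α') + entry α j ≡ entry α' i)

Removable : Composition → ℕ → ℕ → Set
Removable α i z = ∃[ α' ] (Covers α α' × entry α' i ≡ entry α i ∸ z)

tilde : Composition → ℕ → ℕ → ℕ → ℕ
tilde α i z m = if does (m ≟ i) then entry α i ∸ z else entry α m

IsJtilde : Composition → ℕ → ℕ → ℕ → Set
IsJtilde α i z J =
  i < J × c i J (entry α) ≡ c i J (tilde α i z) ×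
  (∀ j → i < j → c i j (entry α) ≡ c i j (tilde α i z) → j ≤ J)

-- Write b = α̃.  For j > i the counters c_{i,j}(α) and c_{i,j}(b) read the same
-- entries α_j, against the thresholds α_i and α_i − z, so
-- c(b) ≤ c(α) ≤ z + c(b) throughout and, once the two counters separate, they
-- stay separated: the j with c_{i,j}(α) = c_{i,j}(b) form an initial segment
-- ending at J̃(i,z).  If α is (i,z)-removable, condition (a4) of the covering
-- gives an index j with c_{i,j}(b) + α_j = α_i − z, at which α's counter moves
-- and b's does not; so J̃(i,z) = j, and α_i − z = c_{i,J̃}(b) + α_{J̃} is
-- determined by J̃, which gives (i).  For z₂ ≤ z₁ the threshold α_i − z₂ lies
-- between α_i − z₁ and α_i, so wherever the counter for z₁ agrees with α's,
-- so does the one for z₂: J̃ is antitone in z, and with (i) this gives (ii).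
module Submission where

open import Defs
open import Data.Nat using (ℕ; zero; suc; _+_; _∸_; _≤_; _<_; _≤′_; _<?_; _≤?_; _≟_; z≤n; s≤s)
open import Data.Nat.Base using (≤′-refl; ≤′-step)
open import Data.Nat.Properties
open import Data.Product using (_×_; _,_; proj₁; proj₂; ∃-syntax)
open import Data.Sum using (inj₁; inj₂)
open import Data.Empty using (⊥-elim)
open import Data.Bool using (true; false; if_then_else_)
open import Relation.Nullary using (¬_; does; yes; no)
open import Relation.Nullary.Decidable using (dec-true; dec-false)
open import Relation.Binary.PropositionalEquality
open import Function.Bundles using (_⇔_; mk⇔)

if-true : ∀ {b} {x y : ℕ} → b ≡ true → (if b then x else y) ≡ x
if-true refl = refl

if-false : ∀ {b} {x y : ℕ} → b ≡ false → (if b then x else y) ≡ y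
if-false refl = refl

-- One step of the recursion for c_{i,j}: x = α_j, t = α_i, k = c_{i,j}(α).
-- Opaque, so that its arguments remain inferable from the types below.
opaque
  tick : ℕ → ℕ → ℕ → ℕ
  tick x t k = if does (x <? t ∸ k) then suc k else k

opaque
  unfolding tick

  tick-inc : ∀ {x} t {k} → x < t ∸ k → tick x t k ≡ suc k
  tick-inc {x} t {k} p = if-true (dec-true (x <? t ∸ k) p)

  tick-stay : ∀ {x} t {k} → ¬ x < t ∸ k → tick x t k ≡ k
  tick-stay {x} t {k} ¬p = if-false (dec-false (x <? t ∸ k) ¬p)

  c-step : ∀ i j f → i < j → c i (suc j) f ≡ tick (f j) (f i) (c i j f)
  c-step i j f i<j = if-false (dec-false (suc j ≤? suc i) (λ { (s≤s j≤i) → <⇒≱ i<j j≤i }))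

tick-inflationary : ∀ x t k → k ≤ tick x t k
tick-inflationary x t k with x <? t ∸ k
... | yes p = ≤-trans (n≤1+n k) (≤-reflexive (sym (tick-inc t p)))
... | no ¬p = ≤-reflexive (sym (tick-stay t ¬p))

tick≤suc : ∀ x t k → tick x t k ≤ suc k
tick≤suc x t k with x <? t ∸ k
... | yes p = ≤-reflexive (tick-inc t p)
... | no ¬p = ≤-trans (≤-reflexive (tick-stay t ¬p)) (n≤1+n k)

tick-monoʳ-≤ : ∀ x t {k k′} → k ≤ k′ → tick x t k ≤ tick x t k′
tick-monoʳ-≤ x t {k} {k′} k≤k′ with m≤n⇒m<n∨m≡n k≤k′
... | inj₂ refl = ≤-refl
... | inj₁ k<k′ = ≤-trans (tick≤suc x t k) (≤-trans k<k′ (tick-inflationary x t k′))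

tick-shift : ∀ x z t k → tick x (z + t) (z + k) ≡ z + tick x t k
tick-shift x z t k with x <? t ∸ k
... | yes p = begin
  tick x (z + t) (z + k)  ≡⟨ tick-inc (z + t) (subst (x <_) (sym ([m+n]∸[m+o]≡n∸o z t k)) p) ⟩
  suc (z + k)             ≡⟨ sym (+-suc z k) ⟩
  z + suc k               ≡⟨ cong (z +_) (sym (tick-inc t p)) ⟩
  z + tick x t k          ∎
  where open ≡-Reasoning
... | no ¬p = begin
  tick x (z + t) (z + k)  ≡⟨ tick-stay (z + t) (subst (λ r → ¬ x < r) (sym ([m+n]∸[m+o]≡n∸o z t k)) ¬p) ⟩
  z + k                   ≡⟨ cong (z +_) (sym (tick-stay t ¬p)) ⟩
  z + tick x t k          ∎
  where open ≡-Reasoning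

tick-mono-≤ : ∀ {x t t′ k k′} → k ≤ k′ → t ∸ k ≤ t′ ∸ k′ → tick x t k ≤ tick x t′ k′
tick-mono-≤ {x} {t} {t′} {k} {k′} k≤k′ r with x <? t ∸ k
... | yes p = subst₂ _≤_ (sym (tick-inc t p)) (sym (tick-inc t′ (≤-trans p r))) (s≤s k≤k′)
... | no ¬p = subst (_≤ tick x t′ k′) (sym (tick-stay t ¬p)) (≤-trans k≤k′ (tick-inflationary x t′ k′))

tick-mono-< : ∀ {x t t′ k k′} → k < k′ → t ∸ k ≤ t′ ∸ k′ → tick x t k < tick x t′ k′
tick-mono-< {x} {t} {t′} {k} {k′} k<k′ r with x <? t ∸ k
... | yes p = subst₂ _<_ (sym (tick-inc t p)) (sym (tick-inc t′ (≤-trans p r))) (s≤s k<k′)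
... | no ¬p = subst (_< tick x t′ k′) (sym (tick-stay t ¬p)) (≤-trans k<k′ (tick-inflationary x t′ k′))

tick-monoˡ-≤ : ∀ {x t t′} k → t ≤ t′ → tick x t k ≤ tick x t′ k
tick-monoˡ-≤ k t≤t′ = tick-mono-≤ ≤-refl (∸-monoˡ-≤ k t≤t′)

tick-squeeze : ∀ {x t₁ t₂ t₃} k → t₁ ≤ t₂ → t₂ ≤ t₃ →
  tick x t₁ k ≡ tick x t₃ k → tick x t₂ k ≡ tick x t₃ k
tick-squeeze k t₁≤t₂ t₂≤t₃ e =
  ≤-antisym (tick-monoˡ-≤ k t₂≤t₃) (subst (_≤ _) e (tick-monoˡ-≤ k t₁≤t₂))

Lag : ℕ → ℕ → ℕ → Set
Lag z k k′ = k ≤ k′ × k′ ≤ z + k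

residual-lag : ∀ {z} t {k k′} → k′ ≤ z + k → t ∸ k ≤ (z + t) ∸ k′
residual-lag {z} t {k} {k′} k′≤z+k =
  ≤-trans (≤-reflexive (sym ([m+n]∸[m+o]≡n∸o z t k))) (∸-monoʳ-≤ (z + t) k′≤z+k)

tick-lag : ∀ x z t {k k′} → Lag z k k′ → Lag z (tick x t k) (tick x (z + t) k′)
tick-lag x z t {k} (k≤k′ , k′≤z+k) =
  tick-mono-≤ k≤k′ (residual-lag t k′≤z+k) ,
  ≤-trans (tick-monoʳ-≤ x (z + t) k′≤z+k) (≤-reflexive (tick-shift x z t k))

tick-separated : ∀ x z t {k k′} → k < k′ → k′ ≤ z + k → tick x t k < tick x (z + t) k′
tick-separated x z t k<k′ k′≤z+k = tick-mono-< k<k′ (residual-lag t k′≤z+k)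

tick-diverges : ∀ {x z t k} → k + x ≡ t → 0 < z → tick x t k < tick x (z + t) k
tick-diverges {x} {z} {t} {k} k+x≡t 0<z =
  subst₂ _<_ (sym (tick-stay t (λ p → <-irrefl refl (subst (x <_) residual p))))
             (sym (tick-inc (z + t) (subst (x <_) (sym raised) (m<n+m x 0<z))))
             (n<1+n k)
  where
  residual : t ∸ k ≡ x
  residual = trans (cong (_∸ k) (sym k+x≡t)) (m+n∸m≡n k x)
  raised : (z + t) ∸ k ≡ z + x
  raised = trans (+-∸-assoc z (subst (k ≤_) k+x≡t (m≤m+n k x))) (cong (z +_) residual)

c-initial : ∀ i j f → j ≤ suc i → c i j f ≡ 0
c-initial i zero    f _   = refl
c-initial i (suc j) f j≤i = if-true (dec-true (suc j ≤? suc i) j≤i)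

c-cong : ∀ i j f g → (∀ k → k < j → f k ≡ g k) → c i j f ≡ c i j g
c-cong i zero    f g f≗g = refl
c-cong i (suc j) f g f≗g with j ≤? i
... | yes j≤i = trans (c-initial i (suc j) f (s≤s j≤i)) (sym (c-initial i (suc j) g (s≤s j≤i)))
... | no j≰i = begin
  c i (suc j) f                ≡⟨ c-step i j f i<j ⟩
  tick (f j) (f i) (c i j f)   ≡⟨ cong₂ (λ x t → tick x t (c i j f)) (f≗g j ≤-refl) (f≗g i (m≤n⇒m≤1+n i<j)) ⟩
  tick (g j) (g i) (c i j f)   ≡⟨ cong (tick (g j) (g i)) (c-cong i j f g (λ k k<j → f≗g k (m≤n⇒m≤1+n k<j))) ⟩
  tick (g j) (g i) (c i j g)   ≡⟨ sym (c-step i j g i<j) ⟩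
  c i (suc j) g                ∎
  where
  open ≡-Reasoning
  i<j : i < j
  i<j = ≰⇒> j≰i

c-step-above : ∀ {i j} {a b : ℕ → ℕ} → (∀ k → i < k → b k ≡ a k) → i < j →
  c i (suc j) b ≡ tick (a j) (b i) (c i j b)
c-step-above {i} {j} {b = b} above i<j =
  trans (c-step i j b i<j) (cong (λ x → tick x (b i) (c i j b)) (above j i<j))

module Lowering {i : ℕ} (z : ℕ) {a b : ℕ → ℕ}
  (lowered : z + b i ≡ a i) (above : ∀ k → i < k → b k ≡ a k) where

  c-step-lowered : ∀ {j} → i < j → c i (suc j) a ≡ tick (a j) (z + b i) (c i j a)
  c-step-lowered {j} i<j = trans (c-step i j a i<j) (cong (λ t → tick (a j) t (c i j a)) (sym lowered))

  c-lag : ∀ j → Lag z (c i j b) (c i j a)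
  c-lag zero = z≤n , z≤n
  c-lag (suc j) with j ≤? i
  ... | yes j≤i = subst₂ (Lag z) (sym (c-initial i (suc j) b (s≤s j≤i)))
                                 (sym (c-initial i (suc j) a (s≤s j≤i))) (z≤n , z≤n)
  ... | no j≰i = subst₂ (Lag z) (sym (c-step-above above (≰⇒> j≰i)))
                                (sym (c-step-lowered (≰⇒> j≰i))) (tick-lag (a j) z (b i) (c-lag j))

  c-separated-step : ∀ j → c i j b < c i j a → c i (suc j) b < c i (suc j) a
  c-separated-step j b<a with j ≤? i
  ... | yes j≤i = ⊥-elim (n≮0 (subst (c i j b <_) (c-initial i j a (m≤n⇒m≤1+n j≤i)) b<a))
  ... | no j≰i = subst₂ _<_ (sym (c-step-above above (≰⇒> j≰i))) (sym (c-step-lowered (≰⇒> j≰i)))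
                            (tick-separated (a j) z (b i) b<a (proj₂ (c-lag j)))

  c-separated-upward : ∀ {k J} → k ≤′ J → c i k b < c i k a → c i J b < c i J a
  c-separated-upward ≤′-refl           b<a = b<a
  c-separated-upward (≤′-step {J} k≤J) b<a = c-separated-step J (c-separated-upward k≤J b<a)

  c-agree-downward : ∀ {k J} → k ≤ J → c i J a ≡ c i J b → c i k a ≡ c i k b
  c-agree-downward {k} k≤J agree with m≤n⇒m<n∨m≡n (proj₁ (c-lag k))
  ... | inj₂ b≡a = sym b≡a
  ... | inj₁ b<a = ⊥-elim (<⇒≢ (c-separated-upward (≤⇒≤′ k≤J) b<a) (sym agree))

  c-diverges : ∀ {j} → i < j → c i j a ≡ c i j b → c i j b + a j ≡ b i → 0 < z →
    c i (suc j) b < c i (suc j) a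
  c-diverges {j} i<j agree tight 0<z =
    subst₂ _<_ (sym (c-step-above above i<j)) (sym (c-step-lowered i<j))
      (subst (λ k → tick (a j) (b i) (c i j b) < tick (a j) (z + b i) k) (sym agree)
        (tick-diverges tight 0<z))

  IsLastAgreement : ℕ → Set
  IsLastAgreement J = i < J × c i J a ≡ c i J b × (∀ j → i < j → c i j a ≡ c i j b → j ≤ J)

  lastAgreement≡divergence : ∀ {j J} → i < j → c i j a ≡ c i j b → c i j b + a j ≡ b i → 0 < z →
    IsLastAgreement J → J ≡ j
  lastAgreement≡divergence {j} {J} i<j agree tight 0<z (_ , agreeJ , maximal) with J ≤? j
  ... | yes J≤j = ≤-antisym J≤j (maximal j i<j agree)
  ... | no J≰j = ⊥-elim (<⇒≢ (c-diverges i<j agree tight 0<z)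
                              (sym (c-agree-downward (≰⇒> J≰j) agreeJ)))

c-agree-sandwich : ∀ {i z₁} {a b₁ b₂ : ℕ → ℕ} →
  z₁ + b₁ i ≡ a i → (∀ k → i < k → b₁ k ≡ a k) →
  b₁ i ≤ b₂ i → b₂ i ≤ a i → (∀ k → i < k → b₂ k ≡ a k) →
  ∀ k → c i k a ≡ c i k b₁ → c i k a ≡ c i k b₂
c-agree-sandwich {i} {z₁} {a} {b₁} {b₂} lowered₁ above₁ b₁≤b₂ b₂≤a above₂ = go
  where
  open Lowering z₁ lowered₁ above₁ using (c-agree-downward)
  go : ∀ k → c i k a ≡ c i k b₁ → c i k a ≡ c i k b₂
  go zero    _     = refl
  go (suc k) agree with k ≤? i
  ... | yes k≤i = trans (c-initial i (suc k) a (s≤s k≤i)) (sym (c-initial i (suc k) b₂ (s≤s k≤i)))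
  ... | no k≰i = begin
    c i (suc k) a                   ≡⟨ c-step i k a i<k ⟩
    tick (a k) (a i) (c i k a)      ≡⟨ sym (tick-squeeze (c i k a) b₁≤b₂ b₂≤a agree₁) ⟩
    tick (a k) (b₂ i) (c i k a)     ≡⟨ cong (tick (a k) (b₂ i)) (go k agree₀) ⟩
    tick (a k) (b₂ i) (c i k b₂)    ≡⟨ sym (c-step-above above₂ i<k) ⟩
    c i (suc k) b₂                  ∎
    where
    open ≡-Reasoning
    i<k : i < k
    i<k = ≰⇒> k≰i
    agree₀ : c i k a ≡ c i k b₁
    agree₀ = c-agree-downward (n≤1+n k) agree
    agree₁ : tick (a k) (b₁ i) (c i k a) ≡ tick (a k) (a i) (c i k a)
    agree₁ = begin
      tick (a k) (b₁ i) (c i k a)   ≡⟨ cong (tick (a k) (b₁ i)) agree₀ ⟩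
      tick (a k) (b₁ i) (c i k b₁)  ≡⟨ sym (c-step-above above₁ i<k) ⟩
      c i (suc k) b₁                ≡⟨ sym agree ⟩
      c i (suc k) a                 ≡⟨ c-step i k a i<k ⟩
      tick (a k) (a i) (c i k a)    ∎

tilde-at : ∀ α i z → tilde α i z i ≡ entry α i ∸ z
tilde-at α i z = if-true (dec-true (i ≟ i) refl)

tilde-off : ∀ α i z k → ¬ k ≡ i → tilde α i z k ≡ entry α k
tilde-off α i z k k≢i = if-false (dec-false (k ≟ i) k≢i)

tilde-above : ∀ α i z k → i < k → tilde α i z k ≡ entry α k
tilde-above α i z k i<k = tilde-off α i z k (λ k≡i → <⇒≢ i<k (sym k≡i))

tilde-lowered : ∀ α i z → z ≤ entry α i → z + tilde α i z i ≡ entry α i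
tilde-lowered α i z z≤αᵢ = trans (cong (z +_) (tilde-at α i z)) (m+[n∸m]≡n z≤αᵢ)

module Tilde (α : Composition) (i z : ℕ) (z≤αᵢ : z ≤ entry α i) =
  Lowering z (tilde-lowered α i z z≤αᵢ) (tilde-above α i z)

removable⇒covering-index : ∀ α i z → 0 < z → z ≤ entry α i → Removable α i z →
  ∃[ j ] (i < j × c i j (entry α) ≡ c i j (tilde α i z) ×
          c i j (tilde α i z) + entry α j ≡ entry α i ∸ z)
removable⇒covering-index α i z 0<z z≤αᵢ
  (α′ , (_ , i′ , j , _ , i′<j , _ , a2 , a3 , a4 , a4′) , α′ᵢ) with i′ ≟ i
... | yes refl = j , i′<j , trans a4 agree , (begin
  c i j (tilde α i z) + entry α j  ≡⟨ cong (_+ entry α j) (sym agree) ⟩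
  c i j (entry α′) + entry α j     ≡⟨ a4′ ⟩
  entry α′ i                       ≡⟨ α′ᵢ ⟩
  entry α i ∸ z                    ∎)
  where
  open ≡-Reasoning
  below-j : ∀ k → k < j → entry α′ k ≡ tilde α i z k
  below-j k k<j with k ≟ i
  ... | yes refl = trans α′ᵢ (sym (tilde-at α i z))
  ... | no k≢i = trans (a3 k k≢i (<⇒≢ k<j)) (sym (tilde-off α i z k k≢i))
  agree : c i j (entry α′) ≡ c i j (tilde α i z)
  agree = c-cong i j _ _ below-j
... | no i′≢i with i ≟ j
...   | yes refl = ⊥-elim (<⇒≱ (∸-monoʳ-< 0<z z≤αᵢ) (subst (entry α i ≤_) (trans (sym a2) α′ᵢ) (m≤m+n _ _)))
...   | no i≢j = ⊥-elim (<⇒≢ (∸-monoʳ-< 0<z z≤αᵢ) (trans (sym α′ᵢ) (a3 i (λ i≡i′ → i′≢i (sym i≡i′)) i≢j)))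

-- The covering index of (a4) is J̃(i,z) itself.
removable⇒Jtilde-tight : ∀ α i z {J} → 0 < z → z ≤ entry α i → Removable α i z → IsJtilde α i z J →
  c i J (tilde α i z) + entry α J ≡ entry α i ∸ z
removable⇒Jtilde-tight α i z 0<z z≤αᵢ removable isJ
  with removable⇒covering-index α i z 0<z z≤αᵢ removable
... | j , i<j , agree , tight
  with Tilde.lastAgreement≡divergence α i z z≤αᵢ i<j agree
         (trans tight (sym (tilde-at α i z))) 0<z isJ
...   | refl = tight

Jtilde-unique : ∀ α i z {J J′} → IsJtilde α i z J → IsJtilde α i z J′ → J ≡ J′
Jtilde-unique α i z {J} {J′} (i<J , agree , maximal) (i<J′ , agree′ , maximal′) =
  ≤-antisym (maximal′ J i<J agree) (maximal J′ i<J′ agree′)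

Jtilde-antimono : ∀ α i {z₁ z₂ J₁ J₂} → z₂ ≤ z₁ → z₁ ≤ entry α i →
  IsJtilde α i z₁ J₁ → IsJtilde α i z₂ J₂ → J₁ ≤ J₂
Jtilde-antimono α i {z₁} {z₂} {J₁} z₂≤z₁ z₁≤αᵢ (i<J₁ , agree₁ , _) (_ , _ , maximal₂) =
  maximal₂ J₁ i<J₁
    (c-agree-sandwich (tilde-lowered α i z₁ z₁≤αᵢ) (tilde-above α i z₁)
       (subst₂ _≤_ (sym (tilde-at α i z₁)) (sym (tilde-at α i z₂)) (∸-monoʳ-≤ (entry α i) z₂≤z₁))
       (subst (_≤ entry α i) (sym (tilde-at α i z₂)) (m∸n≤m (entry α i) z₂))
       (tilde-above α i z₂) J₁ agree₁)

proposition3p7 : (n : ℕ) (α : Composition) → InC n α →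
    (i : ℕ) → 1 ≤ i → i ≤ n ∸ 1 →
    (z₁ z₂ : ℕ) → 1 ≤ z₁ → z₁ ≤ entry α i → 1 ≤ z₂ → z₂ ≤ entry α i →
    Removable α i z₁ → Removable α i z₂ →
    (J₁ J₂ : ℕ) → IsJtilde α i z₁ J₁ → IsJtilde α i z₂ J₂ →
    ((z₁ ≡ z₂) ⇔ (J₁ ≡ J₂)) × ((z₂ < z₁) ⇔ (J₁ < J₂))
proposition3p7 _ α _ i _ _ z₁ z₂ 0<z₁ z₁≤αᵢ 0<z₂ z₂≤αᵢ removable₁ removable₂ J₁ J₂ isJ₁ isJ₂ =
  mk⇔ (λ { refl → Jtilde-unique α i z₁ isJ₁ isJ₂ }) same-J⇒same-z ,
  mk⇔ (λ z₂<z₁ → ≤∧≢⇒< (Jtilde-antimono α i (<⇒≤ z₂<z₁) z₁≤αᵢ isJ₁ isJ₂)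
                         (λ J₁≡J₂ → <⇒≢ z₂<z₁ (sym (same-J⇒same-z J₁≡J₂))))
      (λ J₁<J₂ → ≰⇒> (λ z₁≤z₂ → <⇒≱ J₁<J₂ (Jtilde-antimono α i z₁≤z₂ z₂≤αᵢ isJ₂ isJ₁)))
  where
  open ≡-Reasoning
  same-J⇒same-z : J₁ ≡ J₂ → z₁ ≡ z₂
  same-J⇒same-z refl = ∸-cancelˡ-≡ z₁≤αᵢ z₂≤αᵢ (begin
    entry α i ∸ z₁                     ≡⟨ sym (removable⇒Jtilde-tight α i z₁ 0<z₁ z₁≤αᵢ removable₁ isJ₁) ⟩
    c i J₁ (tilde α i z₁) + entry α J₁ ≡⟨ cong (_+ entry α J₁) (trans (sym (proj₁ (proj₂ isJ₁))) (proj₁ (proj₂ isJ₂))) ⟩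
    c i J₁ (tilde α i z₂) + entry α J₁ ≡⟨ removable⇒Jtilde-tight α i z₂ 0<z₂ z₂≤αᵢ removable₂ isJ₂ ⟩
    entry α i ∸ z₂                     ∎)
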